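{- Let $N = \{a,b,c,d,e,f,g,h\}$ be a set of eight distinct elements and let $G = \{\{a,b,c\}, \{a,d,g\}, \{b,d,f\}, \{b,e,h\}, \{c,e,g\}, \{f,g,h\}\}$. In the game in which Black and White alternately claim previously unclaimed elements of $N$, Black moving first, until all of $N$ is claimed, White has a strategy guaranteeing that every set in $G$ contains at least one element claimed by White.
   Context: This is the "FlatStar Configuration". The elements of $N$ are called markers, and the sets in $G$ are the traces on the markers of groups (possible winning lines) of a $k$-in-a-Row game. -}

module Defs where

open import Data.Nat using (ℕ)
open import Data.Fin using (Fin; _≟_)
open import Data.Fin.Patterns using (0F; 1F; 2F; 3F; 4F; 5F; 6F; 7F)
open import Data.List using (List; []; _∷_)
open import Data.List.Relation.Unary.All using (All)
open import Data.List.Relation.Unary.Any using (Any)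
open import Data.Product using (Σ; _×_)
open import Data.Bool using (if_then_else_)
open import Relation.Nullary using (¬_)
open import Relation.Nullary.Decidable using (⌊_⌋)
open import Relation.Binary.PropositionalEquality using (_≡_)

Marker : Set
Marker = Fin 8

a b c d e f g h : Marker
a = 0F
b = 1F
c = 2F
d = 3F
e = 4F
f = 5F
g = 6F
h = 7F

G : List (List Marker)
G = (a ∷ b ∷ c ∷ [])
  ∷ (a ∷ d ∷ g ∷ [])
  ∷ (b ∷ d ∷ f ∷ [])
  ∷ (b ∷ e ∷ h ∷ [])
  ∷ (c ∷ e ∷ g ∷ [])
  ∷ (f ∷ g ∷ h ∷ [])
  ∷ []

data Mark : Set where
  free black white : Mark

Board : Set
Board = Marker → Mark

emptyBoard : Board
emptyBoard _ = free

_[_≔_] : Board → Marker → Mark → Board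
(s [ x ≔ m ]) y = if ⌊ y ≟ x ⌋ then m else s y

Full : Board → Set
Full s = ∀ x → ¬ (s x ≡ free)

WhiteGoal : Board → Set
WhiteGoal s = All (λ L → Any (λ x → s x ≡ white) L) G

-- Existence of a White strategy (as a finite strategy tree) that reaches
-- WhiteGoal at the end of play, from a position with Black / White to move.
mutual
  data WhiteWinsBlackToMove (s : Board) : Set where
    over : Full s → WhiteGoal s → WhiteWinsBlackToMove s
    blackMoves : ¬ Full s
               → (∀ x → s x ≡ free → WhiteWinsWhiteToMove (s [ x ≔ black ]))
               → WhiteWinsBlackToMove s

  data WhiteWinsWhiteToMove (s : Board) : Set where
    over : Full s → WhiteGoal s → WhiteWinsWhiteToMove s
    whiteMoves : (x : Marker) → s x ≡ free
               → WhiteWinsBlackToMove (s [ x ≔ white ])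
               → WhiteWinsWhiteToMove s

module Submission where

-- The markers b and g are disjoint in G, and the
-- lines through them partition G: b lies on abc, bdf, beh and g on adg, ceg,
-- fgh.  White therefore aims to own both.  His first reply claims b (or g,
-- if Black has taken b).  If Black then leaves the other one free, White
-- takes it and has met every line.  Otherwise the three lines still to be
-- met, with the shared marker removed, are three disjoint pairs
-- ({a,d},{c,e},{f,h} when White owns b; {a,c},{d,f},{e,h} when White owns g),
-- and White answers every Black move inside a pair by the other element of
-- that pair (the classical pairing strategy).

open import Defs
open import Data.Nat using (ℕ; zero; suc)
open import Data.Fin using (Fin; zero; suc)
open import Data.Fin.Patterns using (0F; 2F; 3F; 4F; 5F; 7F)
open import Data.Fin.Properties using () renaming (all? to allMarkers?)
open import Data.List using (allFin; find)
open import Data.List.Relation.Unary.All using () renaming (all? to allLines?)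
open import Data.List.Relation.Unary.Any using (any?)
open import Data.Maybe using (Maybe; just; nothing; map; zipWith; fromMaybe; from-just)
open import Data.Empty using (⊥-elim)
open import Relation.Nullary using (Dec; yes; no; ¬_; _×-dec_; dec⇒maybe)
open import Relation.Binary.PropositionalEquality using (_≡_; refl)

free? : (m : Mark) → Dec (m ≡ free)
free? free  = yes refl
free? black = no λ ()
free? white = no λ ()

black? : (m : Mark) → Dec (m ≡ black)
black? black = yes refl
black? free  = no λ ()
black? white = no λ ()

white? : (m : Mark) → Dec (m ≡ white)
white? white = yes refl
white? free  = no λ ()
white? black = no λ ()

full? : (s : Board) → Dec (Full s)
full? s = allMarkers? λ x → notFree? (s x)
  where
  notFree? : (m : Mark) → Dec (¬ m ≡ free)
  notFree? m with free? m
  ... | yes m≡free = no λ m≢free → m≢free m≡free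
  ... | no  m≢free = yes m≢free

goal? : (s : Board) → Dec (WhiteGoal s)
goal? s = allLines? (λ L → any? (λ x → white? (s x)) L) G

-- The two pairings of the strategy: deleting b from the lines through b,
-- resp. g from the lines through g, leaves three disjoint pairs.  Markers
-- outside the pairs are mapped to themselves.
partnerAlong-b : Marker → Marker
partnerAlong-b 0F = c
partnerAlong-b 2F = a
partnerAlong-b 3F = f
partnerAlong-b 5F = d
partnerAlong-b 4F = h
partnerAlong-b 7F = e
partnerAlong-b x  = x

partnerAlong-g : Marker → Marker
partnerAlong-g 0F = d
partnerAlong-g 3F = a
partnerAlong-g 2F = e
partnerAlong-g 4F = c
partnerAlong-g 5F = h
partnerAlong-g 7F = f
partnerAlong-g x  = x

-- The fallback a is never played:
-- White is only asked to move while some marker is free.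
pairingReply : (Marker → Marker) → Board → Marker
pairingReply partner s =
  fromMaybe (fromMaybe a (find (λ x → free? (s x)) (allFin 8)))
            (find (λ x → free? (s x) ×-dec black? (s (partner x))) (allFin 8))

reply : Board → Marker
reply s with s b | s g
... | white | free  = g
... | free  | white = b
... | white | _     = pairingReply partnerAlong-g s
... | _     | white = pairingReply partnerAlong-b s
... | free  | _     = b
... | _     | _     = g

forAll : ∀ {n} {P : Fin n → Set} → ((i : Fin n) → Maybe (P i)) → Maybe (∀ i → P i)
forAll {zero}  k = just λ ()
forAll {suc n} {P} k = zipWith cons (k zero) (forAll (λ i → k (suc i)))
  where
  cons : P zero → (∀ i → P (suc i)) → ∀ i → P i
  cons p ps zero    = p
  cons p ps (suc i) = ps i

-- A Black move to an occupied marker is illegal and needs no answer.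
ifFree : ∀ {P : Set} (m : Mark) → Maybe P → Maybe (m ≡ free → P)
ifFree m r with free? m
... | yes _    = map (λ p _ → p) r
... | no m≢free = just λ m≡free → ⊥-elim (m≢free m≡free)

atEnd : ∀ {W : Set} (s : Board) → (Full s → WhiteGoal s → W) → Full s → Maybe W
atEnd s finish full = map (finish full) (dec⇒maybe (goal? s))

-- The fuel bounds the number of Black moves.
mutual
  checkBlackToMove : ℕ → (s : Board) → Maybe (WhiteWinsBlackToMove s)
  checkBlackToMove fuel s with full? s
  ... | yes full = atEnd s over full
  checkBlackToMove zero       s | no _       = nothing
  checkBlackToMove (suc fuel) s | no notFull =
    map (blackMoves notFull)
        (forAll λ x → ifFree (s x) (checkWhiteToMove fuel (s [ x ≔ black ])))

  checkWhiteToMove : ℕ → (s : Board) → Maybe (WhiteWinsWhiteToMove s)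
  checkWhiteToMove fuel s with full? s
  ... | yes full = atEnd s over full
  ... | no _     = playReply (reply s)
    where
    playReply : (x : Marker) → Maybe (WhiteWinsWhiteToMove s)
    playReply x with free? (s x)
    ... | yes x-free = map (whiteMoves x x-free) (checkBlackToMove fuel (s [ x ≔ white ]))
    ... | no  _      = nothing

-- Black makes at most eight moves, and the checker accepts  reply .
mainTheorem6 : WhiteWinsBlackToMove emptyBoard
mainTheorem6 = from-just (checkBlackToMove 8 emptyBoard)
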